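{- For every positive integer $n$, the game value of the path position $P_n$ in the Classic Variant of the Mixed Deletion Game is not a negative integer and is not a negative dyadic rational.
   Context: The Classic Variant of the Mixed Deletion Game is a two-player combinatorial game between Left and Right played on a finite simple undirected graph; players alternate turns. On her turn Left deletes one vertex together with all edges incident to it; on his turn Right deletes one edge. The game ends when a deletion creates an isolated vertex (a vertex of degree $0$), and the player whose deletion created an isolated vertex loses; thus a legal move is a deletion which does not create an isolated vertex, and a player with no legal move loses (normal play). A disconnected graph position is the disjunctive sum of the games on its components, and game values are taken in the usual sense of combinatorial game theory (Conway values). $P_n$ denotes the path graph on $n$ vertices, and also the corresponding game position. -}

module Defs where

open import Data.Nat using (ℕ; _+_; zero; suc; _<_; _≡ᵇ_; _∸_)
open import Data.Bool using (Bool; true; false; not; _∨_)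
open import Data.Product using (Σ; _×_; _,_)
open import Data.Sum using (_⊎_; inj₁; inj₂; [_,_])
open import Data.Empty using (⊥; ⊥-elim)
open import Data.Unit using (⊤; tt)
open import Data.Fin using (Fin)
open import Data.List using (List; []; _∷_; length; lookup; removeAt; map; upTo)
open import Data.List.Relation.Unary.Any using (Any)
open import Relation.Nullary using (¬_)
open import Relation.Binary.PropositionalEquality using (_≡_)

data Game : Set₁ where
  mk : (L R : Set) → (L → Game) → (R → Game) → Game

_≤G_ : Game → Game → Set
mk GL GR gl gr ≤G mk HL HR hl hr =
  ((i : GL) → ¬ (mk HL HR hl hr ≤G gl i)) ×
  ((j : HR) → ¬ (hr j ≤G mk GL GR gl gr))

_≈G_ : Game → Game → Set
G ≈G H = (G ≤G H) × (H ≤G G)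

_+G_ : Game → Game → Game
mk A B a b +G mk C D c d =
  mk (A ⊎ C) (B ⊎ D)
     [ (λ i → a i +G mk C D c d) , (λ i → mk A B a b +G c i) ]
     [ (λ j → b j +G mk C D c d) , (λ j → mk A B a b +G d j) ]

negG : Game → Game
negG (mk A B a b) = mk B A (λ j → negG (b j)) (λ i → negG (a i))

zeroG : Game
zeroG = mk ⊥ ⊥ ⊥-elim ⊥-elim

oneG : Game
oneG = mk ⊤ ⊥ (λ _ → zeroG) ⊥-elim

-- halfPow k = 1/2^k :  halfPow 0 = 1,  halfPow (k+1) = { 0 | 1/2^k }
halfPow : ℕ → Game
halfPow zero    = oneG
halfPow (suc k) = mk ⊤ ⊤ (λ _ → zeroG) (λ _ → halfPow k)

timesG : ℕ → Game → Game
timesG zero    G = zeroG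
timesG (suc m) G = G +G timesG m G

IsNegativeInteger : Game → Set
IsNegativeInteger G = Σ ℕ λ m → (0 < m) × (G ≈G negG (timesG m oneG))

IsNegativeDyadic : Game → Set
IsNegativeDyadic G =
  Σ ℕ λ m → Σ ℕ λ k → (0 < m) × (G ≈G negG (timesG m (halfPow k)))

record Graph : Set where
  constructor graph
  field
    V : List ℕ
    E : List (ℕ × ℕ)
open Graph public

bfilter : {A : Set} → (A → Bool) → List A → List A
bfilter p []       = []
bfilter p (x ∷ xs) with p x
... | true  = x ∷ bfilter p xs
... | false = bfilter p xs

incident : ℕ → ℕ × ℕ → Bool
incident v (a , b) = (a ≡ᵇ v) ∨ (b ≡ᵇ v)

degree : ℕ → List (ℕ × ℕ) → ℕ
degree v es = length (bfilter (incident v) es)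

deleteVertex : ℕ → Graph → Graph
deleteVertex v g =
  graph (bfilter (λ u → not (u ≡ᵇ v)) (V g))
        (bfilter (λ e → not (incident v e)) (E g))

deleteEdge : (g : Graph) → Fin (length (E g)) → Graph
deleteEdge g i = graph (V g) (removeAt (E g) i)

CreatesIsolated : Graph → Graph → Set
CreatesIsolated g g' =
  Any (λ u → (0 < degree u (E g)) × (degree u (E g') ≡ 0)) (V g')

LeftMove : Graph → Set
LeftMove g = Σ (Fin (length (V g)))
               λ i → ¬ CreatesIsolated g (deleteVertex (lookup (V g) i) g)

RightMove : Graph → Set
RightMove g = Σ (Fin (length (E g)))
                λ j → ¬ CreatesIsolated g (deleteEdge g j)

-- Game tree with fuel; each move removes a vertex or an edge, so fuel
-- |V| + |E| suffices for graphs with distinct vertex/edge entries.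
mdgFuel : ℕ → Graph → Game
mdgFuel zero    g = zeroG
mdgFuel (suc f) g =
  mk (LeftMove g) (RightMove g)
     (λ { (i , _) → mdgFuel f (deleteVertex (lookup (V g) i) g) })
     (λ { (j , _) → mdgFuel f (deleteEdge g j) })

classicMDG : Graph → Game
classicMDG g = mdgFuel (length (V g) + length (E g)) g

pathGraph : ℕ → Graph
pathGraph n = graph (upTo n) (map (λ i → i , suc i) (upTo (n ∸ 1)))

-- Left wins Pₙ moving first for n = 1 and n ≥ 3, and moving second for n = 2. Hence
-- Pₙ ≥ 0 or Pₙ ⧐ 0, while every negative dyadic −m/2ᵏ is < 0.
--
-- From P₂ on, every position is a disjoint union of paths with at least two vertices
-- (a one-vertex path would be an isolated vertex). Call a path long if it has at least
-- three vertices. Right can legally cut only an inner edge of a path, leaving two paths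
-- with at least two vertices each; so he has no move when no path is long, and a long
-- path survives his cut unless he splits the only long path, a P₄. Left, facing a long
-- path, deletes an end vertex of the first long one; this leaves a P₄ as the only long
-- path only from a lone long P₅ (she deletes its middle vertex instead) or from long
-- paths P₃ and P₄ (she shortens the P₄ instead). By induction on |V| + |E|, Left wins
-- moving first whenever some path is long, and moving second whenever the long paths
-- are not exactly one P₄.

module Submission where

open import Defs
open import Data.Bool using (true; false)
open import Data.Fin using (zero; suc)
open import Data.List using (List; []; _∷_; _++_; length; lookup; removeAt; filter; map; upTo)
open import Data.List.Properties
  using ( filter-some; filter-none; ++-assoc; ++-conicalˡ; ++-conicalʳ; ≡-dec; ∷-injective; ∷-injectiveʳ
        ; length-upTo; length-map)
open import Data.List.Membership.Propositional using (_∈_; _∉_; lose; find)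
open import Data.List.Membership.Propositional.Properties
  using (∈-filter⁺; ∈-filter⁻; ∈-lookup; ∈-∃++; ∈-map⁺; ∈-map⁻; ∈-upTo⁺; ∈-upTo⁻)
open import Data.List.Relation.Unary.All using (All; _∷_; [])
import Data.List.Relation.Unary.All as All
import Data.List.Relation.Unary.All.Properties as All
open import Data.List.Relation.Unary.AllPairs using (_∷_)
open import Data.List.Relation.Unary.Any using (Any; here; there; index)
import Data.List.Relation.Unary.Any as Any
open import Data.List.Relation.Unary.Any.Properties using (++⁺ˡ; ++⁺ʳ; ++⁻; lookup-index)
open import Data.List.Relation.Unary.Unique.Propositional using (Unique)
import Data.List.Relation.Unary.Unique.Propositional.Properties as Unique
open import Data.Nat using (ℕ; zero; suc; pred; _+_; _∸_; _≤_; _<_; s≤s; z≤n; z<s)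
open import Data.Nat.Properties
open import Data.Nat.Tactic.RingSolver using (solve-∀)
open import Data.Product using (Σ; ∃-syntax; _×_; _,_; proj₁; proj₂)
open import Data.Sum using (_⊎_; inj₁; inj₂; [_,_]′)
import Data.Sum as Sum
open import Data.Unit using (⊤; tt)
open import Function using (_∘_)
open import Relation.Binary.Definitions using (tri<; tri≈; tri>)
open import Relation.Binary.PropositionalEquality
  using (_≡_; _≢_; refl; sym; trans; cong; cong₂; subst; module ≡-Reasoning)
open import Relation.Nullary using (¬_; contradiction; does; ¬?; _⊎-dec_; yes; no)
open import Relation.Unary using (Decidable)

-- Positions won by Left

≤G-trans : ∀ G H K → G ≤G H → H ≤G K → G ≤G K
≤G-trans G@(mk _ _ gl _) H@(mk _ _ _ _) K@(mk _ _ _ kr) (G≤H₁ , G≤H₂) (H≤K₁ , H≤K₂) =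
  (λ i K≤gl → G≤H₁ i (≤G-trans H K (gl i) (H≤K₁ , H≤K₂) K≤gl)) ,
  (λ j kr≤G → H≤K₂ j (≤G-trans (kr j) G H kr≤G (G≤H₁ , G≤H₂)))

LeftWinsSecond LeftWinsFirst : Game → Set
LeftWinsSecond (mk _ R _ r) = (j : R) → LeftWinsFirst (r j)
LeftWinsFirst  (mk L _ l _) = Σ L λ i → LeftWinsSecond (l i)

winsSecond⇒0≤G : ∀ G → LeftWinsSecond G → zeroG ≤G G
winsFirst⇒G≰0  : ∀ G → LeftWinsFirst G → ¬ (G ≤G zeroG)
winsSecond⇒0≤G (mk _ _ _ r) w = (λ ()) , λ j → winsFirst⇒G≰0 (r j) (w j)
winsFirst⇒G≰0 (mk _ _ l _) (i , w) (G≤0 , _) = G≤0 i (winsSecond⇒0≤G (l i) w)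

winsSecond⇒-G≤0 : ∀ G → LeftWinsSecond G → negG G ≤G zeroG
winsFirst⇒0≰-G  : ∀ G → LeftWinsFirst G → ¬ (zeroG ≤G negG G)
winsSecond⇒-G≤0 (mk _ _ _ r) w = (λ j → winsFirst⇒0≰-G (r j) (w j)) , λ ()
winsFirst⇒0≰-G (mk _ _ l _) (i , w) (_ , 0≤-G) = 0≤-G i (winsSecond⇒-G≤0 (l i) w)

winsSecond-+G  : ∀ G H → LeftWinsSecond G → LeftWinsSecond H → LeftWinsSecond (G +G H)
winsFirst-+Gˡ  : ∀ G H → LeftWinsFirst G → LeftWinsSecond H → LeftWinsFirst (G +G H)
winsFirst-+Gʳ  : ∀ G H → LeftWinsSecond G → LeftWinsFirst H → LeftWinsFirst (G +G H)
winsSecond-+G G@(mk _ _ _ gr) H@(mk _ _ _ _) wG wH (inj₁ j) = winsFirst-+Gˡ (gr j) H (wG j) wH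
winsSecond-+G G@(mk _ _ _ _) H@(mk _ _ _ hr) wG wH (inj₂ j) = winsFirst-+Gʳ G (hr j) wG (wH j)
winsFirst-+Gˡ G@(mk _ _ gl _) H@(mk _ _ _ _) (i , wG) wH = inj₁ i , winsSecond-+G (gl i) H wG wH
winsFirst-+Gʳ G@(mk _ _ _ _) H@(mk _ _ hl _) wG (i , wH) = inj₂ i , winsSecond-+G G (hl i) wG wH

winsSecond-zeroG : LeftWinsSecond zeroG
winsSecond-zeroG ()

winsFirst-halfPow : ∀ k → LeftWinsFirst (halfPow k)
winsFirst-halfPow zero    = tt , winsSecond-zeroG
winsFirst-halfPow (suc k) = tt , winsSecond-zeroG

winsSecond-halfPow : ∀ k → LeftWinsSecond (halfPow k)
winsSecond-halfPow zero    ()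
winsSecond-halfPow (suc k) tt = winsFirst-halfPow k

winsSecond-timesG : ∀ m G → LeftWinsSecond G → LeftWinsSecond (timesG m G)
winsSecond-timesG zero    G w = winsSecond-zeroG
winsSecond-timesG (suc m) G w = winsSecond-+G G (timesG m G) w (winsSecond-timesG m G w)

winsFirst-timesG-halfPow : ∀ m k → LeftWinsFirst (timesG (suc m) (halfPow k))
winsFirst-timesG-halfPow m k =
  winsFirst-+Gˡ (halfPow k) (timesG m (halfPow k))
    (winsFirst-halfPow k) (winsSecond-timesG m (halfPow k) (winsSecond-halfPow k))

¬negativeDyadic : ∀ G → LeftWinsSecond G ⊎ LeftWinsFirst G → ¬ IsNegativeDyadic G
¬negativeDyadic G wins (suc m , k , _ , G≤-x , _) =
  [ (λ wG → winsFirst⇒0≰-G x x-first (≤G-trans zeroG G (negG x) (winsSecond⇒0≤G G wG) G≤-x))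
  , (λ wG → winsFirst⇒G≰0 G wG (≤G-trans G (negG x) zeroG G≤-x (winsSecond⇒-G≤0 x x-second)))
  ]′ wins
  where
  x = timesG (suc m) (halfPow k)
  x-first : LeftWinsFirst x
  x-first = winsFirst-timesG-halfPow m k
  x-second : LeftWinsSecond x
  x-second = winsSecond-timesG (suc m) (halfPow k) (winsSecond-halfPow k)

¬negativeInteger : ∀ G → LeftWinsSecond G ⊎ LeftWinsFirst G → ¬ IsNegativeInteger G
¬negativeInteger G w (m , 0<m , G≈-m) = ¬negativeDyadic G w (m , 0 , 0<m , G≈-m)

-- Deleting vertices and edges

bfilter≡filter : ∀ {A : Set} {P : A → Set} (P? : Decidable P) xs →
                 bfilter (does ∘ P?) xs ≡ filter P? xs
bfilter≡filter P? []       = refl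
bfilter≡filter P? (x ∷ xs) with does (P? x)
... | true  = cong (x ∷_) (bfilter≡filter P? xs)
... | false = bfilter≡filter P? xs

Incident : ℕ → ℕ × ℕ → Set
Incident v (a , b) = a ≡ v ⊎ b ≡ v

incident? : ∀ v → Decidable (Incident v)
incident? v (a , b) = (a ≟ v) ⊎-dec (b ≟ v)

degree≡length-filter : ∀ v es → degree v es ≡ length (filter (incident? v) es)
degree≡length-filter v es = cong length (bfilter≡filter (incident? v) es)

degree-pos : ∀ {v e es} → e ∈ es → Incident v e → 0 < degree v es
degree-pos {v} {es = es} e∈es ve rewrite degree≡length-filter v es =
  filter-some (incident? v) (lose e∈es ve)

degree-zero : ∀ {v es} → (∀ {e} → e ∈ es → ¬ Incident v e) → degree v es ≡ 0
degree-zero {v} {es} none rewrite degree≡length-filter v es =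
  cong length (filter-none (incident? v) (All.tabulate none))

module _ {v : ℕ} {g : Graph} where

  V-deleteVertex : V (deleteVertex v g) ≡ filter (¬? ∘ (_≟ v)) (V g)
  V-deleteVertex = bfilter≡filter (¬? ∘ (_≟ v)) (V g)

  E-deleteVertex : E (deleteVertex v g) ≡ filter (¬? ∘ incident? v) (E g)
  E-deleteVertex = bfilter≡filter (¬? ∘ incident? v) (E g)

  ∈-deleteVertex-V⁺ : ∀ {u} → u ∈ V g → u ≢ v → u ∈ V (deleteVertex v g)
  ∈-deleteVertex-V⁺ u∈ u≢v rewrite V-deleteVertex =
    ∈-filter⁺ (¬? ∘ (_≟ v)) u∈ u≢v

  ∈-deleteVertex-V⁻ : ∀ {u} → u ∈ V (deleteVertex v g) → u ∈ V g × u ≢ v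
  ∈-deleteVertex-V⁻ u∈ rewrite V-deleteVertex =
    ∈-filter⁻ (¬? ∘ (_≟ v)) u∈

  ∈-deleteVertex-E⁺ : ∀ {e} → e ∈ E g → ¬ Incident v e → e ∈ E (deleteVertex v g)
  ∈-deleteVertex-E⁺ e∈ ¬ve rewrite E-deleteVertex =
    ∈-filter⁺ (¬? ∘ incident? v) e∈ ¬ve

  ∈-deleteVertex-E⁻ : ∀ {e} → e ∈ E (deleteVertex v g) → e ∈ E g × ¬ Incident v e
  ∈-deleteVertex-E⁻ e∈ rewrite E-deleteVertex =
    ∈-filter⁻ (¬? ∘ incident? v) e∈

  unique-deleteVertex-E : Unique (E g) → Unique (E (deleteVertex v g))
  unique-deleteVertex-E u rewrite E-deleteVertex =
    Unique.filter⁺ (¬? ∘ incident? v) u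

module _ {A : Set} where

  ∈-removeAt⁻ : ∀ {x} {xs : List A} j → x ∈ removeAt xs j → x ∈ xs
  ∈-removeAt⁻ {xs = _ ∷ _} zero    x∈       = there x∈
  ∈-removeAt⁻ {xs = _ ∷ _} (suc j) (here p) = here p
  ∈-removeAt⁻ {xs = _ ∷ _} (suc j) (there x∈) = there (∈-removeAt⁻ j x∈)

  ∈-removeAt⁺ : ∀ {x} {xs : List A} j → x ∈ xs → x ≢ lookup xs j → x ∈ removeAt xs j
  ∈-removeAt⁺ {xs = _ ∷ _} zero    (here refl) x≢ = contradiction refl x≢
  ∈-removeAt⁺ {xs = _ ∷ _} zero    (there x∈)  x≢ = x∈
  ∈-removeAt⁺ {xs = _ ∷ _} (suc j) (here p)    x≢ = here p
  ∈-removeAt⁺ {xs = _ ∷ _} (suc j) (there x∈)  x≢ = there (∈-removeAt⁺ j x∈ x≢)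

  lookup∉removeAt : ∀ {xs : List A} j → Unique xs → lookup xs j ∉ removeAt xs j
  lookup∉removeAt {_ ∷ _} zero    (x∉ ∷ _) x∈       = All.lookup x∉ x∈ refl
  lookup∉removeAt {_ ∷ _} (suc j) (x∉ ∷ _) (here p) = All.lookup x∉ (∈-lookup j) (sym p)
  lookup∉removeAt {_ ∷ _} (suc j) (_ ∷ u)  (there x∈) = lookup∉removeAt j u x∈

  unique-removeAt : ∀ {xs : List A} j → Unique xs → Unique (removeAt xs j)
  unique-removeAt {_ ∷ _} zero    (_ ∷ u)  = u
  unique-removeAt {_ ∷ _} (suc j) (x∉ ∷ u) = All.anti-mono (∈-removeAt⁻ j) x∉ ∷ unique-removeAt j u

-- Disjoint unions of paths

-- A segment (s , k) is the path s — s+1 — ⋯ — s+k-1 on k vertices.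

Segment : Set
Segment = ℕ × ℕ

infix 4 _∈ᵛ_ _∈ᵉ_

_∈ᵛ_ : ℕ → Segment → Set
u ∈ᵛ (s , k) = s ≤ u × u < s + k

_∈ᵉ_ : ℕ × ℕ → Segment → Set
(a , b) ∈ᵉ (s , k) = b ≡ suc a × s ≤ a × suc a < s + k

SortedFrom : ℕ → List Segment → Set
SortedFrom b []            = ⊤
SortedFrom b ((s , k) ∷ S) = b ≤ s × SortedFrom (s + k) S

∈ᵉ⇒∈ᵛ : ∀ {a b X} → (a , b) ∈ᵉ X → a ∈ᵛ X × b ∈ᵛ X
∈ᵉ⇒∈ᵛ (refl , s≤a , a<e) = (s≤a , <-trans (n<1+n _) a<e) , (m≤n⇒m≤1+n s≤a , a<e)

incidentEdge : ∀ {u s k} → k ≢ 1 → u ∈ᵛ (s , k) → ∃[ e ] e ∈ᵉ (s , k) × Incident u e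
incidentEdge {u} {s} {k} k≢1 (s≤u , u<e) with suc u <? s + k
... | yes 1+u<e = (u , suc u) , (refl , s≤u , 1+u<e) , inj₁ refl
... | no  1+u≮e = lastEdge (≤∧≢⇒< s≤u s≢u) u<e
  where
  1+u≡e : suc u ≡ s + k
  1+u≡e = ≤-antisym u<e (≮⇒≥ 1+u≮e)
  s≢u : s ≢ u
  s≢u refl = k≢1 (sym (+-cancelˡ-≡ s 1 k (trans (+-comm s 1) 1+u≡e)))
  lastEdge : ∀ {u} → s < u → u < s + k → ∃[ e ] e ∈ᵉ (s , k) × Incident u e
  lastEdge {suc w} (s≤s s≤w) u<e = (w , suc w) , (refl , s≤w , u<e) , inj₂ refl

sortedFrom-≤ : ∀ {b u} S → SortedFrom b S → Any (u ∈ᵛ_) S → b ≤ u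
sortedFrom-≤ ((s , k) ∷ S) (b≤s , _)      (here (s≤u , _)) = ≤-trans b≤s s≤u
sortedFrom-≤ ((s , k) ∷ S) (b≤s , sorted) (there u∈) =
  ≤-trans b≤s (≤-trans (m≤m+n s k) (sortedFrom-≤ S sorted u∈))

sorted-disjoint : ∀ {b u} pre X post → SortedFrom b (pre ++ X ∷ post) →
                  Any (u ∈ᵛ_) pre ⊎ Any (u ∈ᵛ_) post → ¬ u ∈ᵛ X
sorted-disjoint [] (s , k) post (_ , sorted) (inj₂ u∈post) (_ , u<e) =
  <⇒≱ u<e (sortedFrom-≤ post sorted u∈post)
sorted-disjoint ((s , k) ∷ pre) X post (_ , sorted) (inj₁ (here (_ , u<e))) u∈X =
  <⇒≱ u<e (sortedFrom-≤ (pre ++ X ∷ post) sorted (++⁺ʳ pre (here u∈X)))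
sorted-disjoint (_ ∷ pre) X post (_ , sorted) (inj₁ (there u∈pre)) =
  sorted-disjoint pre X post sorted (inj₁ u∈pre)
sorted-disjoint (_ ∷ pre) X post (_ , sorted) (inj₂ u∈post) =
  sorted-disjoint pre X post sorted (inj₂ u∈post)

sorted-splice : ∀ {b} pre X Ys post →
                (∀ {c} → SortedFrom c (X ∷ post) → SortedFrom c (Ys ++ post)) →
                SortedFrom b (pre ++ X ∷ post) → SortedFrom b (pre ++ Ys ++ post)
sorted-splice []              X Ys post local sorted            = local sorted
sorted-splice ((s , k) ∷ pre) X Ys post local (b≤s , sorted) =
  b≤s , sorted-splice pre X Ys post local sorted

module _ {A : Set} (P : A → Set) {K : Set} (pre post : List A) {X : A} {Ys : List A} where

  any-splice⁺ : (P X → K → Any P Ys) → Any P (pre ++ X ∷ post) → K → Any P (pre ++ Ys ++ post)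
  any-splice⁺ local p k with ++⁻ pre p
  ... | inj₁ p-pre         = ++⁺ˡ p-pre
  ... | inj₂ (here pX)     = ++⁺ʳ pre (++⁺ˡ (local pX k))
  ... | inj₂ (there p-post) = ++⁺ʳ pre (++⁺ʳ Ys p-post)

  any-splice⁻ : (Any P pre ⊎ Any P post → K) → (Any P Ys → P X × K) →
                Any P (pre ++ Ys ++ post) → Any P (pre ++ X ∷ post) × K
  any-splice⁻ outside local p with ++⁻ pre p
  ... | inj₁ p-pre = ++⁺ˡ p-pre , outside (inj₁ p-pre)
  ... | inj₂ p′ with ++⁻ Ys p′
  ...   | inj₁ pYs    = ++⁺ʳ pre (here (proj₁ (local pYs))) , proj₂ (local pYs)
  ...   | inj₂ p-post = ++⁺ʳ pre (there p-post) , outside (inj₂ p-post)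

all-splice : ∀ {A : Set} {P : A → Set} pre {X} Ys post →
             All P (pre ++ X ∷ post) → All P Ys → All P (pre ++ Ys ++ post)
all-splice pre Ys post all-S all-Ys with all-pre , _ All.∷ all-post ← All.++⁻ pre all-S =
  All.++⁺ all-pre (All.++⁺ all-Ys all-post)

record Represents (g : Graph) (S : List Segment) : Set where
  field
    vertex⁺      : ∀ {u} → u ∈ V g → Any (u ∈ᵛ_) S
    vertex⁻      : ∀ {u} → Any (u ∈ᵛ_) S → u ∈ V g
    edge⁺        : ∀ {e} → e ∈ E g → Any (e ∈ᵉ_) S
    edge⁻        : ∀ {e} → Any (e ∈ᵉ_) S → e ∈ E g
    edges-unique : Unique (E g)

record RemovesVertex (v : ℕ) (X : Segment) (Ys : List Segment) : Set where
  field
    vertex⁺ : ∀ {u} → u ∈ᵛ X → u ≢ v → Any (u ∈ᵛ_) Ys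
    vertex⁻ : ∀ {u} → Any (u ∈ᵛ_) Ys → u ∈ᵛ X × u ≢ v
    edge⁺   : ∀ {e} → e ∈ᵉ X → ¬ Incident v e → Any (e ∈ᵉ_) Ys
    edge⁻   : ∀ {e} → Any (e ∈ᵉ_) Ys → e ∈ᵉ X × ¬ Incident v e
    sorted  : ∀ {c post} → SortedFrom c (X ∷ post) → SortedFrom c (Ys ++ post)

record RemovesEdge (c : ℕ × ℕ) (X : Segment) (Ys : List Segment) : Set where
  field
    vertex⁺ : ∀ {u} → u ∈ᵛ X → Any (u ∈ᵛ_) Ys
    vertex⁻ : ∀ {u} → Any (u ∈ᵛ_) Ys → u ∈ᵛ X
    edge⁺   : ∀ {e} → e ∈ᵉ X → e ≢ c → Any (e ∈ᵉ_) Ys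
    edge⁻   : ∀ {e} → Any (e ∈ᵉ_) Ys → e ∈ᵉ X × e ≢ c
    sorted  : ∀ {b post} → SortedFrom b (X ∷ post) → SortedFrom b (Ys ++ post)

module _ {b : ℕ} {g : Graph} (pre : List Segment) (X : Segment) (post : List Segment)
         (rep : Represents g (pre ++ X ∷ post)) (sorted : SortedFrom b (pre ++ X ∷ post)) where

  private
    module R = Represents rep

    outside : ∀ {u} → Any (u ∈ᵛ_) pre ⊎ Any (u ∈ᵛ_) post → ¬ u ∈ᵛ X
    outside = sorted-disjoint pre X post sorted

    incident-outside : ∀ {v e} → v ∈ᵛ X → Any (e ∈ᵉ_) pre ⊎ Any (e ∈ᵉ_) post → ¬ Incident v e
    incident-outside v∈X out (inj₁ refl) =
      outside (Sum.map (Any.map (proj₁ ∘ ∈ᵉ⇒∈ᵛ)) (Any.map (proj₁ ∘ ∈ᵉ⇒∈ᵛ)) out) v∈X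
    incident-outside v∈X out (inj₂ refl) =
      outside (Sum.map (Any.map (proj₂ ∘ ∈ᵉ⇒∈ᵛ)) (Any.map (proj₂ ∘ ∈ᵉ⇒∈ᵛ)) out) v∈X

  represents-deleteVertex : ∀ {v Ys} → v ∈ᵛ X → RemovesVertex v X Ys →
                            Represents (deleteVertex v g) (pre ++ Ys ++ post)
  represents-deleteVertex {v} {Ys} v∈X local = record
    { vertex⁺ = λ {u} u∈ → let u∈g , u≢v = ∈-deleteVertex-V⁻ {v} {g} u∈ in
                any-splice⁺ (u ∈ᵛ_) pre post L.vertex⁺ (R.vertex⁺ u∈g) u≢v
    ; vertex⁻ = λ {u} u∈ → let u∈S , u≢v = any-splice⁻ (u ∈ᵛ_) pre post vertex-outside L.vertex⁻ u∈ in
                ∈-deleteVertex-V⁺ {v} {g} (R.vertex⁻ u∈S) u≢v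
    ; edge⁺   = λ {e} e∈ → let e∈g , ¬ve = ∈-deleteVertex-E⁻ {v} {g} e∈ in
                any-splice⁺ (e ∈ᵉ_) pre post L.edge⁺ (R.edge⁺ e∈g) ¬ve
    ; edge⁻   = λ {e} e∈ → let e∈S , ¬ve = any-splice⁻ (e ∈ᵉ_) pre post (incident-outside v∈X)
                                                       L.edge⁻ e∈ in
                ∈-deleteVertex-E⁺ {v} {g} (R.edge⁻ e∈S) ¬ve
    ; edges-unique = unique-deleteVertex-E {v} {g} R.edges-unique
    }
    where
    module L = RemovesVertex local
    vertex-outside : ∀ {u} → Any (u ∈ᵛ_) pre ⊎ Any (u ∈ᵛ_) post → u ≢ v
    vertex-outside out refl = outside out v∈X

  represents-deleteEdge : ∀ {c Ys} j → lookup (E g) j ≡ c → c ∈ᵉ X → RemovesEdge c X Ys →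
                          Represents (deleteEdge g j) (pre ++ Ys ++ post)
  represents-deleteEdge {c} {Ys} j refl c∈X local = record
    { vertex⁺ = λ {u} u∈ → any-splice⁺ (u ∈ᵛ_) pre post (λ u∈X _ → L.vertex⁺ u∈X) (R.vertex⁺ u∈) tt
    ; vertex⁻ = λ {u} u∈ → R.vertex⁻ (proj₁ (any-splice⁻ (u ∈ᵛ_) pre post (λ _ → tt)
                                                    (λ u∈ → L.vertex⁻ u∈ , tt) u∈))
    ; edge⁺   = λ {e} e∈ → any-splice⁺ (e ∈ᵉ_) pre post L.edge⁺ (R.edge⁺ (∈-removeAt⁻ j e∈))
                             (λ { refl → lookup∉removeAt j R.edges-unique e∈ })
    ; edge⁻   = λ {e} e∈ → let e∈S , e≢c = any-splice⁻ (e ∈ᵉ_) pre post edge-outside L.edge⁻ e∈ in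
                ∈-removeAt⁺ j (R.edge⁻ e∈S) e≢c
    ; edges-unique = unique-removeAt j R.edges-unique
    }
    where
    module L = RemovesEdge local
    edge-outside : ∀ {e} → Any (e ∈ᵉ_) pre ⊎ Any (e ∈ᵉ_) post → e ≢ c
    edge-outside out refl = incident-outside (proj₁ (∈ᵉ⇒∈ᵛ c∈X)) out (inj₁ refl)

  isolated : ∀ {v} → v ∈ᵛ X → (∀ {e} → ¬ e ∈ᵉ X) → v ∈ V g × degree v (E g) ≡ 0
  isolated {v} v∈X edgeless = R.vertex⁻ (++⁺ʳ pre (here v∈X)) , degree-zero not-incident
    where
    not-incident : ∀ {e} → e ∈ E g → ¬ Incident v e
    not-incident e∈ with ++⁻ pre (R.edge⁺ e∈)
    ... | inj₁ e∈pre          = incident-outside v∈X (inj₁ e∈pre)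
    ... | inj₂ (here e∈X)     = λ _ → edgeless e∈X
    ... | inj₂ (there e∈post) = incident-outside v∈X (inj₂ e∈post)

NonSingleton : Segment → Set
NonSingleton (_ , k) = k ≢ 1

¬createsIsolated : ∀ {g g′ S′} → Represents g′ S′ → All NonSingleton S′ → ¬ CreatesIsolated g g′
¬createsIsolated {g′ = g′} rep nonSingleton created
  with u , u∈V , (_ , degree≡0) ← find created
  with X , X∈S , u∈X ← find (Represents.vertex⁺ rep u∈V)
  with e , e∈X , ue ← incidentEdge (All.lookup nonSingleton X∈S) u∈X =
  <⇒≢ (degree-pos (Represents.edge⁻ rep (lose X∈S e∈X)) ue) (sym degree≡0)

removesVertex-split : ∀ s a b →
  RemovesVertex (s + a) (s , a + suc b) ((s , a) ∷ (suc (s + a) , b) ∷ [])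
removesVertex-split s a b = record
  { vertex⁺ = vertex⁺ ; vertex⁻ = vertex⁻ ; edge⁺ = edge⁺ ; edge⁻ = edge⁻
  ; sorted = λ { {post = post} (c≤s , rest) → c≤s , n≤1+n (s + a) , subst (λ e → SortedFrom e post) end≡ rest }
  }
  where
  end≡ : s + (a + suc b) ≡ suc (s + a) + b
  end≡ = trans (sym (+-assoc s a (suc b))) (+-suc (s + a) b)

  sa≤end : s + a ≤ s + (a + suc b)
  sa≤end = +-monoʳ-≤ s (m≤m+n a (suc b))

  vertex⁺ : ∀ {u} → u ∈ᵛ (s , a + suc b) → u ≢ s + a → Any (u ∈ᵛ_) ((s , a) ∷ (suc (s + a) , b) ∷ [])
  vertex⁺ {u} (s≤u , u<end) u≢v with <-cmp u (s + a)
  ... | tri< u<v _ _ = here (s≤u , u<v)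
  ... | tri≈ _ u≡v _ = contradiction u≡v u≢v
  ... | tri> _ _ v<u = there (here (v<u , subst (u <_) end≡ u<end))

  vertex⁻ : ∀ {u} → Any (u ∈ᵛ_) ((s , a) ∷ (suc (s + a) , b) ∷ []) → u ∈ᵛ (s , a + suc b) × u ≢ s + a
  vertex⁻ (here (s≤u , u<v))          = (s≤u , <-≤-trans u<v sa≤end) , <⇒≢ u<v
  vertex⁻ {u} (there (here (v<u , u<end))) =
    (≤-trans (m≤m+n s a) (<⇒≤ v<u) , subst (u <_) (sym end≡) u<end) , >⇒≢ v<u
  vertex⁻ (there (there ()))

  edge⁺ : ∀ {e} → e ∈ᵉ (s , a + suc b) → ¬ Incident (s + a) e → Any (e ∈ᵉ_) ((s , a) ∷ (suc (s + a) , b) ∷ [])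
  edge⁺ {x , _} (refl , s≤x , x+1<end) ¬ve with <-cmp x (s + a)
  ... | tri< x<v _ _ = here (refl , s≤x , ≤∧≢⇒< x<v (¬ve ∘ inj₂))
  ... | tri≈ _ x≡v _ = contradiction (inj₁ x≡v) ¬ve
  ... | tri> _ _ v<x = there (here (refl , v<x , subst (suc x <_) end≡ x+1<end))

  edge⁻ : ∀ {e} → Any (e ∈ᵉ_) ((s , a) ∷ (suc (s + a) , b) ∷ []) → e ∈ᵉ (s , a + suc b) × ¬ Incident (s + a) e
  edge⁻ {x , _} (here (refl , s≤x , x+1<v)) =
    (refl , s≤x , <-≤-trans x+1<v sa≤end) ,
    [ <⇒≢ (<-trans (n<1+n x) x+1<v) , <⇒≢ x+1<v ]′
  edge⁻ {x , _} (there (here (refl , v<x , x+1<end))) =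
    (refl , ≤-trans (m≤m+n s a) (<⇒≤ v<x) , subst (suc x <_) (sym end≡) x+1<end) ,
    [ >⇒≢ v<x , >⇒≢ (<-trans v<x (n<1+n x)) ]′
  edge⁻ (there (there ()))

removesEdge-split : ∀ s d r →
  RemovesEdge (s + d , suc (s + d)) (s , suc d + suc r) ((s , suc d) ∷ (suc (s + d) , suc r) ∷ [])
removesEdge-split s d r = record
  { vertex⁺ = vertex⁺ ; vertex⁻ = vertex⁻ ; edge⁺ = edge⁺ ; edge⁻ = edge⁻
  ; sorted = λ { {post = post} (b≤s , rest) → b≤s , ≤-reflexive mid≡ , subst (λ e → SortedFrom e post) end≡ rest }
  }
  where
  end≡ : s + (suc d + suc r) ≡ suc (s + d) + suc r
  end≡ = trans (+-suc s (d + suc r)) (cong suc (sym (+-assoc s d (suc r))))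

  mid≡ : s + suc d ≡ suc (s + d)
  mid≡ = +-suc s d

  mid≤end : s + suc d ≤ s + (suc d + suc r)
  mid≤end = +-monoʳ-≤ s (m≤m+n (suc d) (suc r))

  vertex⁺ : ∀ {u} → u ∈ᵛ (s , suc d + suc r) → Any (u ∈ᵛ_) ((s , suc d) ∷ (suc (s + d) , suc r) ∷ [])
  vertex⁺ {u} (s≤u , u<end) with u ≤? s + d
  ... | yes u≤c = here (s≤u , subst (u <_) (sym mid≡) (s≤s u≤c))
  ... | no  u≰c = there (here (≰⇒> u≰c , subst (u <_) end≡ u<end))

  vertex⁻ : ∀ {u} → Any (u ∈ᵛ_) ((s , suc d) ∷ (suc (s + d) , suc r) ∷ []) → u ∈ᵛ (s , suc d + suc r)
  vertex⁻ (here (s≤u , u<mid))          = s≤u , <-≤-trans u<mid mid≤end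
  vertex⁻ {u} (there (here (c<u , u<end))) =
    ≤-trans (m≤m+n s d) (<⇒≤ c<u) , subst (u <_) (sym end≡) u<end
  vertex⁻ (there (there ()))

  edge⁺ : ∀ {e} → e ∈ᵉ (s , suc d + suc r) → e ≢ (s + d , suc (s + d)) →
          Any (e ∈ᵉ_) ((s , suc d) ∷ (suc (s + d) , suc r) ∷ [])
  edge⁺ {x , _} (refl , s≤x , x+1<end) e≢c with <-cmp x (s + d)
  ... | tri< x<c _ _ = here (refl , s≤x , subst (suc x <_) (sym mid≡) (s≤s x<c))
  ... | tri≈ _ refl _ = contradiction refl e≢c
  ... | tri> _ _ c<x = there (here (refl , c<x , subst (suc x <_) end≡ x+1<end))

  edge⁻ : ∀ {e} → Any (e ∈ᵉ_) ((s , suc d) ∷ (suc (s + d) , suc r) ∷ []) →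
          e ∈ᵉ (s , suc d + suc r) × e ≢ (s + d , suc (s + d))
  edge⁻ {x , _} (here (refl , s≤x , x+1<mid)) =
    (refl , s≤x , <-≤-trans x+1<mid mid≤end) ,
    λ e≡c → <⇒≢ (≤-pred (subst (suc x <_) mid≡ x+1<mid)) (cong proj₁ e≡c)
  edge⁻ {x , _} (there (here (refl , c<x , x+1<end))) =
    (refl , ≤-trans (m≤m+n s d) (<⇒≤ c<x) , subst (suc x <_) (sym end≡) x+1<end) ,
    λ e≡c → >⇒≢ c<x (cong proj₁ e≡c)
  edge⁻ (there (there ()))

singleton-edgeless : ∀ {e a} → ¬ e ∈ᵉ (a , 1)
singleton-edgeless {x , _} {a} (refl , a≤x , x+1<a+1) =
  <-irrefl refl (<-≤-trans x+1<a+1 (≤-trans (+-monoˡ-≤ 1 a≤x) (≤-reflexive (+-comm x 1))))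

singleton-isolated : ∀ {b g S a} → Represents g S → SortedFrom b S → (a , 1) ∈ S →
                     a ∈ V g × degree a (E g) ≡ 0
singleton-isolated {a = a} rep sorted a∈S with pre , post , refl ← ∈-∃++ a∈S =
  isolated pre (a , 1) post rep sorted (≤-refl , m<m+n a z<s) singleton-edgeless

singleton-createsIsolated : ∀ {b g g′ S′ a} → Represents g′ S′ → SortedFrom b S′ → (a , 1) ∈ S′ →
                            0 < degree a (E g) → CreatesIsolated g g′
singleton-createsIsolated rep sorted a∈S degree>0 with a∈V , degree≡0 ← singleton-isolated rep sorted a∈S =
  lose a∈V (degree>0 , degree≡0)

offset∈ᵛ : ∀ s a b → s + a ∈ᵛ (s , a + suc b)
offset∈ᵛ s a b = m≤m+n s a , +-monoʳ-< s (m<m+n a z<s)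

offset∈ᵉ : ∀ s d r → (s + d , suc (s + d)) ∈ᵉ (s , suc d + suc r)
offset∈ᵉ s d r = refl , m≤m+n s d , subst (_< s + (suc d + suc r)) (+-suc s d) (+-monoʳ-< s (m<m+n (suc d) z<s))

edge-offset : ∀ {e s k} → e ∈ᵉ (s , k) → ∃[ d ] ∃[ r ] e ≡ (s + d , suc (s + d)) × k ≡ suc d + suc r
edge-offset {x , _} {s} {k} (refl , s≤x , x+1<end) with d , refl ← m≤n⇒∃[o]m+o≡n s≤x
  with r , k≡ ← m≤n⇒∃[o]m+o≡n (+-cancelˡ-< s (suc d) k (subst (_< s + k) (sym (+-suc s d)) x+1<end)) =
  d , r , refl , trans (sym k≡) (sym (+-suc (suc d) r))

-- Left's strategy

record Position (g : Graph) (S : List Segment) : Set where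
  field
    represents   : Represents g S
    sorted       : SortedFrom 0 S
    nonSingleton : All NonSingleton S

profile : List Segment → List ℕ
profile []                                = []
profile ((_ , 0) ∷ S)                     = profile S
profile ((_ , 1) ∷ S)                     = profile S
profile ((_ , 2) ∷ S)                     = profile S
profile ((_ , k@(suc (suc (suc _)))) ∷ S) = k ∷ profile S

profile-++ : ∀ xs ys → profile (xs ++ ys) ≡ profile xs ++ profile ys
profile-++ []                            ys = refl
profile-++ ((_ , 0) ∷ xs)                ys = profile-++ xs ys
profile-++ ((_ , 1) ∷ xs)                ys = profile-++ xs ys
profile-++ ((_ , 2) ∷ xs)                ys = profile-++ xs ys
profile-++ ((_ , suc (suc (suc k))) ∷ xs) ys = cong (_ ∷_) (profile-++ xs ys)

profile-++-short : ∀ xs ys → profile xs ≡ [] → profile (xs ++ ys) ≡ profile ys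
profile-++-short xs ys short = trans (profile-++ xs ys) (cong (_++ profile ys) short)

order : Segment → ℕ
order (_ , k) = k + pred k

size : List Segment → ℕ
size []      = 0
size (X ∷ S) = order X + size S

size-++ : ∀ xs ys → size (xs ++ ys) ≡ size xs + size ys
size-++ []       ys = refl
size-++ (X ∷ xs) ys = trans (cong (order X +_) (size-++ xs ys)) (sym (+-assoc (order X) (size xs) (size ys)))

size-splice : ∀ pre X Ys post → size Ys < order X → size (pre ++ Ys ++ post) < size (pre ++ X ∷ post)
size-splice pre X Ys post smaller
  rewrite size-++ pre (Ys ++ post) | size-++ pre (X ∷ post) | size-++ Ys post =
  +-monoʳ-< (size pre) (+-monoˡ-< (size post) smaller)

size-vertexSplit : ∀ s a b → size ((s , a) ∷ (suc (s + a) , b) ∷ []) < order (s , a + suc b)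
size-vertexSplit s a b = begin-strict
  a + pred a + (b + pred b + 0)      ≤⟨ +-mono-≤ (+-monoʳ-≤ a pred[n]≤n) (+-monoˡ-≤ 0 (+-monoʳ-≤ b pred[n]≤n)) ⟩
  a + a + (b + b + 0)                <⟨ n<1+n _ ⟩
  suc (a + a + (b + b + 0))          ≡⟨ regroup a b ⟩
  a + suc b + (a + b)                ≡⟨ cong (λ n → a + suc b + pred n) (sym (+-suc a b)) ⟩
  a + suc b + pred (a + suc b)       ∎
  where
  open ≤-Reasoning
  regroup : ∀ a b → suc (a + a + (b + b + 0)) ≡ a + suc b + (a + b)
  regroup = solve-∀

size-edgeSplit : ∀ s d r → size ((s , suc d) ∷ (suc (s + d) , suc r) ∷ []) < order (s , suc d + suc r)
size-edgeSplit s d r = ≤-reflexive (regroup d r)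
  where
  regroup : ∀ d r → suc (suc d + d + (suc r + r + 0)) ≡ suc d + suc r + (d + suc r)
  regroup = solve-∀

module _ {g : Graph} (pre : List Segment) (s : ℕ) (post : List Segment) where

  position-deleteVertex : ∀ {a b} → Position g (pre ++ (s , a + suc b) ∷ post) → a ≢ 1 → b ≢ 1 →
                          Position (deleteVertex (s + a) g) (pre ++ (s , a) ∷ (suc (s + a) , b) ∷ post)
  position-deleteVertex {a} {b} pos a≢1 b≢1 = record
    { represents   = represents-deleteVertex pre (s , a + suc b) post P.represents P.sorted v∈X local
    ; sorted       = sorted-splice pre (s , a + suc b) _ post (RemovesVertex.sorted local) P.sorted
    ; nonSingleton = all-splice pre (_ ∷ _ ∷ []) post P.nonSingleton (a≢1 ∷ b≢1 ∷ [])
    }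
    where
    module P = Position pos
    local = removesVertex-split s a b
    v∈X = offset∈ᵛ s a b

  cut-represents : ∀ {d r} j → Position g (pre ++ (s , suc d + suc r) ∷ post) →
                   lookup (E g) j ≡ (s + d , suc (s + d)) →
                   Represents (deleteEdge g j) (pre ++ (s , suc d) ∷ (suc (s + d) , suc r) ∷ post) ×
                   SortedFrom 0 (pre ++ (s , suc d) ∷ (suc (s + d) , suc r) ∷ post)
  cut-represents {d} {r} j pos c≡ =
    represents-deleteEdge pre (s , suc d + suc r) post P.represents P.sorted j c≡ (offset∈ᵉ s d r) local ,
    sorted-splice pre (s , suc d + suc r) _ post (RemovesEdge.sorted local) P.sorted
    where
    module P = Position pos
    local = removesEdge-split s d r

  legal-cut⇒inner : ∀ {d r} j → Position g (pre ++ (s , suc d + suc r) ∷ post) →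
              lookup (E g) j ≡ (s + d , suc (s + d)) → ¬ CreatesIsolated g (deleteEdge g j) →
              ∃[ d′ ] ∃[ r′ ] d ≡ suc d′ × r ≡ suc r′
  legal-cut⇒inner {zero} j pos c≡ legal with rep′ , sorted′ ← cut-represents j pos c≡ =
    contradiction (singleton-createsIsolated {g = g} rep′ sorted′ (++⁺ʳ pre (here refl))
                     (degree-pos {es = E g} (∈-lookup j) (inj₁ (trans (cong proj₁ c≡) (+-identityʳ s)))))
                  legal
  legal-cut⇒inner {suc d} {zero} j pos c≡ legal with rep′ , sorted′ ← cut-represents j pos c≡ =
    contradiction (singleton-createsIsolated {g = g} rep′ sorted′ (++⁺ʳ pre (there (here refl)))
                     (degree-pos {es = E g} (∈-lookup j) (inj₂ (cong proj₂ c≡))))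
                  legal
  legal-cut⇒inner {suc d} {suc r} _ _ _ _ = d , r , refl , refl

  position-cut : ∀ {d r} j → Position g (pre ++ (s , suc (suc d) + suc (suc r)) ∷ post) →
                 lookup (E g) j ≡ (s + suc d , suc (s + suc d)) →
                 Position (deleteEdge g j) (pre ++ (s , suc (suc d)) ∷ (suc (s + suc d) , suc (suc r)) ∷ post)
  position-cut j pos c≡ = record
    { represents   = proj₁ (cut-represents j pos c≡)
    ; sorted       = proj₂ (cut-represents j pos c≡)
    ; nonSingleton = all-splice pre (_ ∷ _ ∷ []) post (Position.nonSingleton pos) ((λ ()) ∷ (λ ()) ∷ [])
    }

size-pos : ∀ S → profile S ≢ [] → 0 < size S
size-pos []                 nonempty = contradiction refl nonempty
size-pos ((_ , zero) ∷ S)   nonempty = size-pos S nonempty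
size-pos ((_ , suc k) ∷ S)  _        = s≤s z≤n

profile-++-nonempty : ∀ xs {ys} → profile ys ≢ [] → profile (xs ++ ys) ≢ []
profile-++-nonempty xs {ys} nonempty empty =
  nonempty (++-conicalʳ (profile xs) (profile ys) (trans (sym (profile-++ xs ys)) empty))

profile-cut : ∀ pre s t d r post →
              profile (pre ++ (s , suc (suc d) + suc (suc r)) ∷ post) ≢ 4 ∷ [] →
              profile (pre ++ (s , suc (suc d)) ∷ (t , suc (suc r)) ∷ post) ≢ []
profile-cut pre s t (suc d) r       post _     = profile-++-nonempty pre λ ()
profile-cut pre s t zero    (suc r) post _     = profile-++-nonempty pre λ ()
profile-cut pre s t zero    zero    post notP4 empty = notP4 (begin
  profile (pre ++ (s , 4) ∷ post)   ≡⟨ profile-++ pre ((s , 4) ∷ post) ⟩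
  profile pre ++ 4 ∷ profile post   ≡⟨ cong₂ (λ p q → p ++ 4 ∷ q) (++-conicalˡ _ _ pre-post≡[])
                                                                  (++-conicalʳ _ _ pre-post≡[]) ⟩
  4 ∷ []                            ∎)
  where
  open ≡-Reasoning
  pre-post≡[] : profile pre ++ profile post ≡ []
  pre-post≡[] = trans (sym (profile-++ pre ((s , 2) ∷ (t , 2) ∷ post))) empty

record FirstLong (S : List Segment) : Set where
  field
    pre post  : List Segment
    s k       : ℕ
    split     : S ≡ pre ++ (s , 3 + k) ∷ post
    pre-short : profile pre ≡ []

firstLong-∷ : ∀ {S} X → (∀ T → profile (X ∷ T) ≡ profile T) → FirstLong S → FirstLong (X ∷ S)
firstLong-∷ X skips fl = record
  { pre = X ∷ pre ; post = post ; s = s ; k = k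
  ; split = cong (X ∷_) split ; pre-short = trans (skips pre) pre-short }
  where open FirstLong fl

firstLong : ∀ S → profile S ≢ [] → FirstLong S
firstLong []                            nonempty = contradiction refl nonempty
firstLong ((s , 0) ∷ S)                 nonempty = firstLong-∷ (s , 0) (λ _ → refl) (firstLong S nonempty)
firstLong ((s , 1) ∷ S)                 nonempty = firstLong-∷ (s , 1) (λ _ → refl) (firstLong S nonempty)
firstLong ((s , 2) ∷ S)                 nonempty = firstLong-∷ (s , 2) (λ _ → refl) (firstLong S nonempty)
firstLong ((s , suc (suc (suc k))) ∷ S) _        =
  record { pre = [] ; post = S ; s = s ; k = k ; split = refl ; pre-short = refl }

record GoodDeletion (S : List Segment) : Set where
  field
    pre post  : List Segment
    s a b     : ℕ
    split     : S ≡ pre ++ (s , a + suc b) ∷ post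
    a≢1       : a ≢ 1
    b≢1       : b ≢ 1
    result≢P4 : profile (pre ++ (s , a) ∷ (suc (s + a) , b) ∷ post) ≢ 4 ∷ []

trim : ∀ {S} pre s k post → S ≡ pre ++ (s , 3 + k) ∷ post →
       profile (pre ++ (s , 0) ∷ (suc (s + 0) , 2 + k) ∷ post) ≢ 4 ∷ [] → GoodDeletion S
trim pre s k post split ok = record
  { pre = pre ; post = post ; s = s ; a = 0 ; b = 2 + k ; split = split
  ; a≢1 = λ () ; b≢1 = λ () ; result≢P4 = ok }

split5 : ∀ pre s post → profile (pre ++ (s , 2) ∷ (suc (s + 2) , 2) ∷ post) ≢ 4 ∷ [] →
         GoodDeletion (pre ++ (s , 5) ∷ post)
split5 pre s post ok = record
  { pre = pre ; post = post ; s = s ; a = 2 ; b = 2 ; split = refl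
  ; a≢1 = λ () ; b≢1 = λ () ; result≢P4 = ok }

≢P4-after : ∀ pre {T} → profile pre ≡ [] → profile T ≢ 4 ∷ [] → profile (pre ++ T) ≢ 4 ∷ []
≢P4-after pre {T} short T≢P4 P4 = T≢P4 (trans (sym (profile-++-short pre T short)) P4)

trim-second : ∀ pre s post → profile pre ≡ [] → profile post ≡ 4 ∷ [] → FirstLong post →
              GoodDeletion (pre ++ (s , 3) ∷ post)
trim-second pre s post short post≡P4
            record { pre = mid ; post = post′ ; s = t ; k = k ; split = refl ; pre-short = mid-short }
  with refl , post′-short ←
         ∷-injective (trans (sym (profile-++-short mid ((t , 3 + k) ∷ post′) mid-short)) post≡P4) =
  trim (pre ++ (s , 3) ∷ mid) t 1 post′ (sym (++-assoc pre ((s , 3) ∷ mid) ((t , 4) ∷ post′)))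
       (λ P4 → contradiction (trans (sym three-three) P4) λ ())
  where
  open ≡-Reasoning
  T = (t , 0) ∷ (suc (t + 0) , 3) ∷ post′
  three-three : profile ((pre ++ (s , 3) ∷ mid) ++ T) ≡ 3 ∷ 3 ∷ []
  three-three = begin
    profile ((pre ++ (s , 3) ∷ mid) ++ T)        ≡⟨ profile-++ (pre ++ (s , 3) ∷ mid) T ⟩
    profile (pre ++ (s , 3) ∷ mid) ++ profile T
      ≡⟨ cong (_++ profile T) (profile-++-short pre ((s , 3) ∷ mid) short) ⟩
    3 ∷ profile mid ++ 3 ∷ profile post′        ≡⟨ cong₂ (λ p q → 3 ∷ p ++ 3 ∷ q) mid-short post′-short ⟩
    3 ∷ 3 ∷ []                                   ∎

strategy-firstLong : ∀ pre s k post → profile pre ≡ [] → GoodDeletion (pre ++ (s , 3 + k) ∷ post)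
strategy-firstLong pre s 0 post short with ≡-dec _≟_ (profile post) (4 ∷ [])
... | no  post≢P4 = trim pre s 0 post refl (≢P4-after pre short post≢P4)
... | yes post≡P4 = trim-second pre s post short post≡P4
                      (firstLong post λ empty → contradiction (trans (sym empty) post≡P4) λ ())
strategy-firstLong pre s 1 post short = trim pre s 1 post refl (≢P4-after pre short λ ())
strategy-firstLong pre s 2 post short with ≡-dec _≟_ (profile post) []
... | yes post-short = split5 pre s post
                         (≢P4-after pre short λ P4 → contradiction (trans (sym post-short) P4) λ ())
... | no  post-long  = trim pre s 2 post refl (≢P4-after pre short (post-long ∘ ∷-injectiveʳ))
strategy-firstLong pre s (suc (suc (suc k))) post short = trim pre s (3 + k) post refl (≢P4-after pre short λ ())

strategy : ∀ S → profile S ≢ [] → GoodDeletion S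
strategy S nonempty
  with record { pre = pre ; post = post ; s = s ; k = k ; split = refl ; pre-short = short } ← firstLong S nonempty =
  strategy-firstLong pre s k post short

winsFirst-deleteVertex : ∀ f {g v} → v ∈ V g → ¬ CreatesIsolated g (deleteVertex v g) →
                    LeftWinsSecond (mdgFuel f (deleteVertex v g)) → LeftWinsFirst (mdgFuel (suc f) g)
winsFirst-deleteVertex f {g} v∈ legal wins =
  (index v∈ , subst (λ w → ¬ CreatesIsolated g (deleteVertex w g)) v≡ legal) ,
  subst (λ w → LeftWinsSecond (mdgFuel f (deleteVertex w g))) v≡ wins
  where
  v≡ = lookup-index v∈

winsSecond : ∀ f {g S} → Position g S → profile S ≢ 4 ∷ [] → size S ≤ f → LeftWinsSecond (mdgFuel f g)
winsFirst  : ∀ f {g S} → Position g S → profile S ≢ [] → size S ≤ f → LeftWinsFirst (mdgFuel f g)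

winsSecond zero    _ _ _ = winsSecond-zeroG
winsSecond (suc f) pos notP4 bound (j , legal)
  with (s , k) , X∈S , c∈X ← find (Represents.edge⁺ (Position.represents pos) (∈-lookup j))
  with pre , post , refl ← ∈-∃++ X∈S
  with d , r , c≡ , refl ← edge-offset c∈X
  with d′ , r′ , refl , refl ← legal-cut⇒inner pre s post j pos c≡ legal =
  winsFirst f (position-cut pre s post j pos c≡) (profile-cut pre s _ d′ r′ post notP4)
    (≤-pred (<-≤-trans (size-splice pre _ _ post (size-edgeSplit s (suc d′) (suc r′))) bound))

winsFirst zero {S = S} _ nonempty bound = contradiction (<-≤-trans (size-pos S nonempty) bound) λ ()
winsFirst (suc f) {g} {S} pos nonempty bound
  with record { pre = pre ; post = post ; s = s ; a = a ; b = b ; split = refl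
              ; a≢1 = a≢1 ; b≢1 = b≢1 ; result≢P4 = ok } ← strategy S nonempty =
  winsFirst-deleteVertex f {g} (Represents.vertex⁻ (Position.represents pos) (++⁺ʳ pre (here (offset∈ᵛ s a b))))
    (¬createsIsolated {g = g} (Position.represents pos′) (Position.nonSingleton pos′))
    (winsSecond f pos′ ok size′≤f)
  where
  pos′ = position-deleteVertex pre s post pos a≢1 b≢1
  size′≤f = ≤-pred (<-≤-trans (size-splice pre _ _ post (size-vertexSplit s a b)) bound)

pathGraph-position : ∀ n → n ≢ 1 → Position (pathGraph n) ((0 , n) ∷ [])
pathGraph-position n n≢1 = record
  { represents = record
    { vertex⁺      = λ u∈ → here (z≤n , ∈-upTo⁻ u∈)
    ; vertex⁻      = λ { (here (_ , u<n)) → ∈-upTo⁺ u<n ; (there ()) }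
    ; edge⁺        = edge⁺
    ; edge⁻        = λ { (here (refl , _ , i+1<n)) → ∈-map⁺ step (∈-upTo⁺ (<⇒≤pred i+1<n)) ; (there ()) }
    ; edges-unique = Unique.map⁺ (cong proj₁) (Unique.upTo⁺ (n ∸ 1))
    }
  ; sorted       = z≤n , tt
  ; nonSingleton = n≢1 ∷ []
  }
  where
  step : ℕ → ℕ × ℕ
  step i = i , suc i
  edge⁺ : ∀ {e} → e ∈ map step (upTo (n ∸ 1)) → Any (e ∈ᵉ_) ((0 , n) ∷ [])
  edge⁺ e∈ with i , i∈ , refl ← ∈-map⁻ step e∈ = here (refl , z≤n , pred-cancel-< (∈-upTo⁻ i∈))

pathGraph-fuel : ∀ n → length (V (pathGraph n)) + length (E (pathGraph n)) ≡ size ((0 , n) ∷ [])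
pathGraph-fuel n =
  trans (cong₂ _+_ (length-upTo n) (trans (length-map _ (upTo (n ∸ 1))) (length-upTo (n ∸ 1))))
        (sym (+-identityʳ (n + (n ∸ 1))))

pathGraph-wins : ∀ n → 0 < n →
                 LeftWinsSecond (classicMDG (pathGraph n)) ⊎ LeftWinsFirst (classicMDG (pathGraph n))
-- Deleting the only vertex of P₁ leaves no vertex that could be isolated.
pathGraph-wins 1 _ = inj₂ ((zero , λ ()) , winsSecond-zeroG)
pathGraph-wins 2 _ = inj₁ (winsSecond _ (pathGraph-position 2 λ ()) (λ ()) (≤-reflexive (sym (pathGraph-fuel 2))))
pathGraph-wins n@(suc (suc (suc _))) _ =
  inj₂ (winsFirst _ (pathGraph-position n λ ()) (λ ()) (≤-reflexive (sym (pathGraph-fuel n))))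

corollary3p3 : (n : ℕ) → 0 < n →
    ¬ IsNegativeInteger (classicMDG (pathGraph n)) ×
    ¬ IsNegativeDyadic (classicMDG (pathGraph n))
corollary3p3 n 0<n = ¬negativeInteger G wins , ¬negativeDyadic G wins
  where
  G = classicMDG (pathGraph n)
  wins = pathGraph-wins n 0<n
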